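{- Let $S$ be the set of all transpositions in $S_n$ and let $X$ be the complete transposition graph $\mathrm{Cay}(S_n,S)$. Let $L_e(X)$ denote the set of automorphisms of $X$ that fix the vertex $e$ and each of its neighbors. Then $L_e(X) = \{1, h\}$, where $h : V(X) \to V(X)$ is the map $\alpha \mapsto \alpha^{ -1}$.
   Context: For a group $H$ and a subset $S \subseteq H$ with $1 \notin S$ and $S = S^{ -1}$, the Cayley graph $\mathrm{Cay}(H,S)$ is the simple undirected graph with vertex set $H$ and edges $\{h, sh\}$ for $h \in H$, $s \in S$. Here $e$ is the identity of $S_n$. -}

module Defs where

open import Data.Nat using (ℕ)
open import Data.Fin using (Fin)
open import Data.Product using (Σ; ∃; ∃-syntax; _×_)
open import Data.Sum using (_⊎_)
open import Relation.Binary.PropositionalEquality using (_≡_)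
open import Relation.Nullary using (¬_)
open import Data.Fin.Permutation
  using (Permutation′; _⟨$⟩ʳ_; _≈_; id; flip; _∘ₚ_; transpose)

-- Group product  σ · τ  (apply τ first, then σ) is  τ ∘ₚ σ  in the stdlib.
Sym : ℕ → Set
Sym n = Permutation′ n

e : ∀ {n} → Sym n
e = id

inv : ∀ {n} → Sym n → Sym n
inv = flip

IsTransposition : ∀ {n} → Sym n → Set
IsTransposition {n} s = ∃[ i ] ∃[ j ] (¬ (i ≡ j) × s ≈ transpose {n} i j)

-- adjacency in the complete transposition graph X = Cay(S_n, S):
-- edge {h, s h} for s a transposition; i.e. β = s · α for a transposition s.
Adj : ∀ {n} → Sym n → Sym n → Set
Adj α β = ∃[ s ] (IsTransposition s × β ≈ (α ∘ₚ s))

IsAutomorphism : ∀ {n} → (Sym n → Sym n) → Set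
IsAutomorphism {n} φ =
  (∀ α β → α ≈ β → φ α ≈ φ β) ×
  (∀ α β → φ α ≈ φ β → α ≈ β) ×
  (∀ β → ∃[ α ] (φ α ≈ β)) ×
  (∀ α β → (Adj α β → Adj (φ α) (φ β)) × (Adj (φ α) (φ β) → Adj α β))

InLe : ∀ {n} → (Sym n → Sym n) → Set
InLe {n} φ =
  IsAutomorphism φ × (φ e ≈ e) × (∀ β → Adj e β → φ β ≈ β)

_≗ₚ_ : ∀ {n} → (Sym n → Sym n) → (Sym n → Sym n) → Set
φ ≗ₚ ψ = ∀ α → φ α ≈ ψ α

module Submission where

-- A vertex is pinned down by the fixed vertices it is adjacent to. An automorphism ψ fixing e and
-- the transpositions therefore fixes every double transposition (the common neighbours of (a b)
-- and (c d) are e and (a b)(c d)) and sends each 3-cycle to itself or to its inverse (the common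
-- neighbours of (a b) and (b c)); comparing common neighbours of double transpositions shows that
-- all 3-cycles behave alike, so ψ or inv ∘ ψ fixes the ball of radius 2 around e. Conjugating by
-- translations, an automorphism fixing the ball around a vertex fixes the ball around each
-- neighbour, since the inverting alternative would have to fix and invert a 3-cycle at once; the
-- graph is connected.
--
-- Each vertex involved moves at most four points, so the facts used about it are statements about
-- S₃ or S₄: they are decided by computation there and transported to S_n along embeddings
-- Fin m ↣ Fin n.

open import Defs
open import Data.Nat using (ℕ)
open import Data.Product using (_×_)
open import Data.Sum using (_⊎_)
open import Function using (id)

open import Data.Nat using (zero; suc; _≤_; _<_; _<?_; z≤n)
open import Data.Nat.Properties using (≤-<-trans; m≤n⇒m<n∨m≡n; <-irrefl)
open import Data.Fin using (Fin; zero; suc; toℕ; fromℕ<)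
open import Data.Fin.Patterns using (0F; 1F; 2F; 3F)
open import Data.Fin.Properties using (_≟_; all?; toℕ-injective; toℕ-fromℕ<; toℕ<n)
import Data.Fin.Properties as Fin
open import Data.Fin.Permutation using (_⟨$⟩ʳ_; _⟨$⟩ˡ_; transpose; _∘ₚ_; _≈_; inverseˡ; inverseʳ)
open import Data.Fin.Permutation.Components using (transpose-inverse) renaming (transpose to tr)
open import Data.List using (List; []; _∷_; _++_)
open import Data.List.Relation.Unary.Any using (Any; here; there; any?)
import Data.List.Relation.Unary.Any as Any
open import Data.Vec using (Vec; lookup; []; _∷_)
open import Data.Product using (_,_; ∃; proj₁; proj₂)
import Data.Product as Prod
open import Data.Sum using (inj₁; inj₂; [_,_]′)
open import Data.Empty using (⊥-elim)
open import Function using (_∘_; Injective)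
open import Function.Bundles using (_↣_; Injection; mk↣)
open import Function.Construct.Composition using (_↣-∘_)
open import Relation.Binary.PropositionalEquality
open import Relation.Nullary using (¬_; Dec; yes; no; ¬?; contradiction)
open import Relation.Nullary.Decidable
  using (map′; _×-dec_; _→-dec_; True; False; toWitness; toWitnessFalse; from-yes; from-no;
         dec-true; dec-false)
open Injection using (to; injective)

private variable
  m n : ℕ
  i j k l x : Fin n
  f f′ g g′ : Fin n → Fin n
  α β σ : Sym n
  φ ψ : Sym n → Sym n

-- Transpositions of Fin n

position : (x i j : Fin n) → x ≡ i ⊎ (x ≢ i × x ≡ j) ⊎ (x ≢ i × x ≢ j)
position x i j with x ≟ i | x ≟ j
... | yes x≡i | _      = inj₁ x≡i
... | no x≢i | yes x≡j = inj₂ (inj₁ (x≢i , x≡j))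
... | no x≢i | no x≢j  = inj₂ (inj₂ (x≢i , x≢j))

tr-left : (i j : Fin n) → tr i j i ≡ j
tr-left i j rewrite dec-true (i ≟ i) refl = refl

tr-right : (i j : Fin n) → tr i j j ≡ i
tr-right i j with j ≟ i
... | yes j≡i = j≡i
... | no _ rewrite dec-true (j ≟ j) refl = refl

tr-fix : x ≢ i → x ≢ j → tr i j x ≡ x
tr-fix {x = x} {i} {j} x≢i x≢j rewrite dec-false (x ≟ i) x≢i | dec-false (x ≟ j) x≢j = refl

tr-comm : (i j x : Fin n) → tr i j x ≡ tr j i x
tr-comm i j x with position x i j
... | inj₁ refl                = trans (tr-left x j) (sym (tr-right j x))
... | inj₂ (inj₁ (_ , refl))   = trans (tr-right i x) (sym (tr-left x i))
... | inj₂ (inj₂ (x≢i , x≢j)) = trans (tr-fix x≢i x≢j) (sym (tr-fix x≢j x≢i))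

tr-involutive : (i j x : Fin n) → tr i j (tr i j x) ≡ x
tr-involutive i j x = trans (cong (tr i j) (tr-comm i j x)) (transpose-inverse i j)

tr-natural : {f : Fin m → Fin n} → Injective _≡_ _≡_ f →
             (i j x : Fin m) → tr (f i) (f j) (f x) ≡ f (tr i j x)
tr-natural {f = f} f-inj i j x with position x i j
... | inj₁ refl                = trans (tr-left (f x) (f j)) (cong f (sym (tr-left x j)))
... | inj₂ (inj₁ (_ , refl))   = trans (tr-right (f i) (f x)) (cong f (sym (tr-right i x)))
... | inj₂ (inj₂ (x≢i , x≢j)) =
  trans (tr-fix (x≢i ∘ f-inj) (x≢j ∘ f-inj)) (cong f (sym (tr-fix x≢i x≢j)))

tr-determined : i ≢ j → tr k l i ≡ j → ∀ x → tr k l x ≡ tr i j x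
tr-determined {i = i} {j} {k} {l} i≢j kl-i≡j x with position i k l
... | inj₁ refl              = cong (λ j → tr i j x) (trans (sym (tr-left i l)) kl-i≡j)
... | inj₂ (inj₁ (_ , refl)) =
  trans (tr-comm k i x) (cong (λ k → tr i k x) (trans (sym (tr-right k i)) kl-i≡j))
... | inj₂ (inj₂ (i≢k , i≢l)) = contradiction (trans (sym (tr-fix i≢k i≢l)) kl-i≡j) i≢j

-- The complete transposition graph

⟦_⟧ : Sym n → Fin n → Fin n
⟦ α ⟧ = α ⟨$⟩ʳ_

⟦⟧-injective : (α : Sym n) → Injective _≡_ _≡_ ⟦ α ⟧
⟦⟧-injective α eq = trans (sym (inverseˡ α)) (trans (cong (α ⟨$⟩ˡ_) eq) (inverseˡ α))

infix 4 _∼_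
record _∼_ (f g : Fin n → Fin n) : Set where
  constructor edge
  field
    p q      : Fin n
    distinct : p ≢ q
    step     : ∀ x → g x ≡ tr p q (f x)

_∼?_ : (f g : Fin n → Fin n) → Dec (f ∼ g)
f ∼? g = map′ (λ (i , j , i≢j , g≈) → edge i j i≢j g≈) (λ (edge i j i≢j g≈) → i , j , i≢j , g≈)
  (Fin.any? λ i → Fin.any? λ j → ¬? (i ≟ j) ×-dec all? λ x → g x ≟ tr i j (f x))

∼-resp : (∀ x → f x ≡ f′ x) → (∀ x → g x ≡ g′ x) → f ∼ g → f′ ∼ g′
∼-resp f≈ g≈ (edge i j i≢j g≈f) =
  edge i j i≢j λ x → trans (sym (g≈ x)) (trans (g≈f x) (cong (tr i j) (f≈ x)))

∼-∘ʳ : (h : Fin n → Fin n) → f ∼ g → (f ∘ h) ∼ (g ∘ h)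
∼-∘ʳ h (edge i j i≢j g≈f) = edge i j i≢j (g≈f ∘ h)

Adj⇒∼ : Adj α β → ⟦ α ⟧ ∼ ⟦ β ⟧
Adj⇒∼ {α = α} (_ , (i , j , i≢j , s≈) , β≈) = edge i j i≢j λ x → trans (β≈ x) (s≈ (⟦ α ⟧ x))

∼⇒Adj : ⟦ α ⟧ ∼ ⟦ β ⟧ → Adj α β
∼⇒Adj (edge i j i≢j β≈) = transpose i j , (i , j , i≢j , λ _ → refl) , β≈

data Ball₂ (c : Fin n → Fin n) : (Fin n → Fin n) → Set where
  one : c ∼ f → Ball₂ c f
  two : c ∼ g → g ∼ f → Ball₂ c f

Ball₂-resp : (∀ x → f x ≡ f′ x) → Ball₂ f g → Ball₂ f′ g
Ball₂-resp f≈ (one f∼g)       = one (∼-resp f≈ (λ _ → refl) f∼g)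
Ball₂-resp f≈ (two f∼h h∼g) = two (∼-resp f≈ (λ _ → refl) f∼h) h∼g

Ball₂-∘ʳ : (h : Fin n → Fin n) → Ball₂ f g → Ball₂ (f ∘ h) (g ∘ h)
Ball₂-∘ʳ h (one f∼g)        = one (∼-∘ʳ h f∼g)
Ball₂-∘ʳ h (two f∼g′ g′∼g) = two (∼-∘ʳ h f∼g′) (∼-∘ʳ h g′∼g)

Ball₂-centre : {f : Fin n → Fin n} {i j : Fin n} → i ≢ j → Ball₂ f f
Ball₂-centre {f = f} {i} {j} i≢j =
  two (edge i j i≢j λ _ → refl) (edge i j i≢j λ x → sym (tr-involutive i j (f x)))

FixesBall₂ : (Sym n → Sym n) → Sym n → Set
FixesBall₂ φ α = ∀ β → Ball₂ ⟦ α ⟧ ⟦ β ⟧ → φ β ≈ β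

inv-unique : (∀ y → ⟦ β ⟧ (g y) ≡ y) → ∀ y → ⟦ inv β ⟧ y ≡ g y
inv-unique {β = β} βg≈id y = trans (cong (β ⟨$⟩ˡ_) (sym (βg≈id y))) (inverseˡ β)

inv-cong : α ≈ β → inv α ≈ inv β
inv-cong {α = α} {β} α≈β y = sym (inv-unique {β = β} (λ z → trans (sym (α≈β _)) (inverseʳ α)) y)

inv-∼ : ⟦ α ⟧ ∼ ⟦ β ⟧ → ⟦ inv α ⟧ ∼ ⟦ inv β ⟧
inv-∼ {α = α} {β} (edge i j i≢j β≈) =
  edge (⟦ inv α ⟧ i) (⟦ inv α ⟧ j) (i≢j ∘ ⟦⟧-injective (inv α)) λ y → begin
    ⟦ inv β ⟧ y                               ≡⟨ inv-unique {β = β} β∘α⁻¹∘tr≈id y ⟩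
    ⟦ inv α ⟧ (tr i j y)                      ≡˘⟨ tr-natural (⟦⟧-injective (inv α)) i j y ⟩
    tr (⟦ inv α ⟧ i) (⟦ inv α ⟧ j) (⟦ inv α ⟧ y) ∎
  where
  open ≡-Reasoning
  β∘α⁻¹∘tr≈id : ∀ y → ⟦ β ⟧ (⟦ inv α ⟧ (tr i j y)) ≡ y
  β∘α⁻¹∘tr≈id y = trans (β≈ _) (trans (cong (tr i j) (inverseʳ α)) (tr-involutive i j y))

-- Words in transpositions, transported along embeddings Fin m ↣ Fin n

Word : ℕ → Set
Word n = List (Fin n × Fin n)

-- ∘ₚ composes left to right, so ⟦ perm ((i , j) ∷ w) ⟧ = tr i j ∘ ⟦ perm w ⟧.
perm : Word n → Sym n
perm []            = e
perm ((i , j) ∷ w) = perm w ∘ₚ transpose i j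

rename : (Fin m → Fin n) → Word m → Word n
rename f = Data.List.map (Prod.map f f)

_at_ : Word m → Vec (Fin n) m → Word n
w at v = rename (lookup v) w

⟪_⟫ : Word m → Fin m ↣ Fin n → Sym n
⟪ w ⟫ ι = perm (rename (to ι) w)

⟪⟫-pointwise : {ι κ : Fin m ↣ Fin n} → (∀ k → to ι k ≡ to κ k) → (w : Word m) → ⟪ w ⟫ ι ≈ ⟪ w ⟫ κ
⟪⟫-pointwise             ι≈κ []            x = refl
⟪⟫-pointwise {ι = ι} {κ} ι≈κ ((i , j) ∷ w) x =
  trans (cong₂ (λ a b → tr a b (⟦ ⟪ w ⟫ ι ⟧ x)) (ι≈κ i) (ι≈κ j))
        (cong (tr (to κ i) (to κ j)) (⟪⟫-pointwise {ι = ι} {κ} ι≈κ w x))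

_≈?_ : (α β : Sym n) → Dec (α ≈ β)
α ≈? β = all? λ x → ⟦ α ⟧ x ≟ ⟦ β ⟧ x

injective? : (f : Fin m → Fin n) → Dec (∀ x y → f x ≡ f y → x ≡ y)
injective? f = all? λ x → all? λ y → (f x ≟ f y) →-dec (x ≟ y)

select : (v : Vec (Fin n) m) → {True (injective? (lookup v))} → Fin m ↣ Fin n
select v {v-inj} = mk↣ (toWitness v-inj _ _)

cons : (s : Fin n) (ι : Fin m ↣ Fin n) → (∀ k → to ι k ≢ s) → Fin (suc m) ↣ Fin n
cons {n} {m} s ι fresh = mk↣ {to = to′} injective′
  where
  to′ : Fin (suc m) → Fin n
  to′ zero    = s
  to′ (suc k) = to ι k
  injective′ : Injective _≡_ _≡_ to′
  injective′ {zero}  {zero}  _  = refl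
  injective′ {zero}  {suc k} eq = contradiction (sym eq) (fresh k)
  injective′ {suc k} {zero}  eq = contradiction eq (fresh k)
  injective′ {suc k} {suc l} eq = cong suc (injective ι eq)

single : Fin n → Fin 1 ↣ Fin n
single a = mk↣ {to = λ _ → a} λ { {0F} {0F} _ → refl }

triple : {a b c : Fin n} → a ≢ b → a ≢ c → b ≢ c → Fin 3 ↣ Fin n
triple a≢b a≢c b≢c =
  cons _ (cons _ (single _) λ { 0F → b≢c ∘ sym }) λ { 0F → a≢b ∘ sym ; 1F → a≢c ∘ sym }

quadruple : {a b c d : Fin n} → a ≢ b → a ≢ c → a ≢ d → b ≢ c → b ≢ d → c ≢ d → Fin 4 ↣ Fin n
quadruple a≢b a≢c a≢d b≢c b≢d c≢d =
  cons _ (triple b≢c b≢d c≢d) λ { 0F → a≢b ∘ sym ; 1F → a≢c ∘ sym ; 2F → a≢d ∘ sym }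

CommonNeighboursAmong : Word m → Word m → List (Word m) → Set
CommonNeighboursAmong u v cs = ∀ i j → i ≢ j → ⟦ perm v ⟧ ∼ ⟦ perm ((i , j) ∷ u) ⟧ →
  Any (λ c → perm ((i , j) ∷ u) ≈ perm c) cs

commonNeighboursAmong? : (u v : Word m) (cs : List (Word m)) → Dec (CommonNeighboursAmong u v cs)
commonNeighboursAmong? u v cs = all? λ i → all? λ j → ¬? (i ≟ j) →-dec
  (⟦ perm v ⟧ ∼? ⟦ perm ((i , j) ∷ u) ⟧) →-dec any? (λ c → perm ((i , j) ∷ u) ≈? perm c) cs

module Transfer (ι : Fin m ↣ Fin n) where

  ⟪⟫-natural : (w : Word m) (x : Fin m) → ⟦ ⟪ w ⟫ ι ⟧ (to ι x) ≡ to ι (⟦ perm w ⟧ x)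
  ⟪⟫-natural []            x = refl
  ⟪⟫-natural ((i , j) ∷ w) x =
    trans (cong (tr (to ι i) (to ι j)) (⟪⟫-natural w x)) (tr-natural (injective ι) i j _)

  ⟪⟫-outside : (∀ k → to ι k ≢ x) → (w : Word m) → ⟦ ⟪ w ⟫ ι ⟧ x ≡ x
  ⟪⟫-outside out []            = refl
  ⟪⟫-outside out ((i , j) ∷ w) =
    trans (cong (tr (to ι i) (to ι j)) (⟪⟫-outside out w)) (tr-fix (out i ∘ sym) (out j ∘ sym))

  inImage? : (x : Fin n) → (∃ λ k → to ι k ≡ x) ⊎ (∀ k → to ι k ≢ x)
  inImage? x with Fin.any? (λ k → to ι k ≟ x)
  ... | yes found = inj₁ found
  ... | no ¬found = inj₂ λ k eq → ¬found (k , eq)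

  ⟪⟫-cong : {u v : Word m} → perm u ≈ perm v → ⟪ u ⟫ ι ≈ ⟪ v ⟫ ι
  ⟪⟫-cong {u} {v} u≈v x with inImage? x
  ... | inj₁ (k , refl) = trans (⟪⟫-natural u k) (trans (cong (to ι) (u≈v k)) (sym (⟪⟫-natural v k)))
  ... | inj₂ out        = trans (⟪⟫-outside out u) (sym (⟪⟫-outside out v))

  ⟪⟫-reflect : {u v : Word m} → ⟪ u ⟫ ι ≈ ⟪ v ⟫ ι → perm u ≈ perm v
  ⟪⟫-reflect {u} {v} eq x =
    injective ι (trans (sym (⟪⟫-natural u x)) (trans (eq (to ι x)) (⟪⟫-natural v x)))

  ∼-transfer : {u v : Word m} → ⟦ perm u ⟧ ∼ ⟦ perm v ⟧ → ⟦ ⟪ u ⟫ ι ⟧ ∼ ⟦ ⟪ v ⟫ ι ⟧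
  ∼-transfer {u} {v} (edge i j i≢j v≈) =
    edge (to ι i) (to ι j) (i≢j ∘ injective ι) (⟪⟫-cong {v} {(i , j) ∷ u} v≈)

  -- A point outside the image is fixed by both sides, so (i j) cannot move it.
  endpoint-in-image : {u v : Word m} → i ≢ j → (∀ x → ⟦ ⟪ v ⟫ ι ⟧ x ≡ tr i j (⟦ ⟪ u ⟫ ι ⟧ x)) →
                      ∃ λ k → to ι k ≡ i
  endpoint-in-image {i = i} {j} {u} {v} i≢j v≈ with inImage? i
  ... | inj₁ found = found
  ... | inj₂ out   = contradiction (begin
    i                        ≡˘⟨ ⟪⟫-outside out v ⟩
    ⟦ ⟪ v ⟫ ι ⟧ i            ≡⟨ v≈ i ⟩
    tr i j (⟦ ⟪ u ⟫ ι ⟧ i)   ≡⟨ cong (tr i j) (⟪⟫-outside out u) ⟩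
    tr i j i                 ≡⟨ tr-left i j ⟩
    j                        ∎) i≢j
    where open ≡-Reasoning

  ∼-reflect : {u v : Word m} → ⟦ ⟪ u ⟫ ι ⟧ ∼ ⟦ ⟪ v ⟫ ι ⟧ → ⟦ perm u ⟧ ∼ ⟦ perm v ⟧
  ∼-reflect {u} {v} (edge i j i≢j v≈)
    with endpoint-in-image {u = u} {v} i≢j v≈
       | endpoint-in-image {u = u} {v} (i≢j ∘ sym) (λ x → trans (v≈ x) (tr-comm i j (⟦ ⟪ u ⟫ ι ⟧ x)))
  ... | i′ , refl | j′ , refl = edge i′ j′ (i≢j ∘ cong (to ι)) λ x → injective ι (begin
    to ι (⟦ perm v ⟧ x)                               ≡˘⟨ ⟪⟫-natural v x ⟩
    ⟦ ⟪ v ⟫ ι ⟧ (to ι x)                              ≡⟨ v≈ (to ι x) ⟩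
    tr (to ι i′) (to ι j′) (⟦ ⟪ u ⟫ ι ⟧ (to ι x))     ≡⟨ cong (tr (to ι i′) (to ι j′)) (⟪⟫-natural u x) ⟩
    tr (to ι i′) (to ι j′) (to ι (⟦ perm u ⟧ x))      ≡⟨ tr-natural (injective ι) i′ j′ _ ⟩
    to ι (tr i′ j′ (⟦ perm u ⟧ x))                    ∎)
    where open ≡-Reasoning

  -- If i lay outside the image, f i ≡ j would force (k l) = (i j), hence ⟪ u ⟫ ι ≈ ⟪ v ⟫ ι.
  commonNeighbour-endpoint : {u v : Word m} → ¬ perm u ≈ perm v → i ≢ j →
    (∀ x → f x ≡ tr i j (⟦ ⟪ u ⟫ ι ⟧ x)) → ⟦ ⟪ v ⟫ ι ⟧ ∼ f → ∃ λ k → to ι k ≡ i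
  commonNeighbour-endpoint {i = i} {j} {f} {u} {v} u≉v i≢j f≈u (edge k l _ f≈v) with inImage? i
  ... | inj₁ found = found
  ... | inj₂ out   = contradiction (⟪⟫-reflect {u} {v} ⟪u⟫≈⟪v⟫) u≉v
    where
    open ≡-Reasoning
    kl-i≡j : tr k l i ≡ j
    kl-i≡j = begin
      tr k l i                 ≡˘⟨ cong (tr k l) (⟪⟫-outside out v) ⟩
      tr k l (⟦ ⟪ v ⟫ ι ⟧ i)   ≡˘⟨ f≈v i ⟩
      f i                      ≡⟨ f≈u i ⟩
      tr i j (⟦ ⟪ u ⟫ ι ⟧ i)   ≡⟨ cong (tr i j) (⟪⟫-outside out u) ⟩
      tr i j i                 ≡⟨ tr-left i j ⟩
      j                        ∎
    ⟪u⟫≈⟪v⟫ : ⟪ u ⟫ ι ≈ ⟪ v ⟫ ι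
    ⟪u⟫≈⟪v⟫ x = begin
      ⟦ ⟪ u ⟫ ι ⟧ x                    ≡˘⟨ tr-involutive i j (⟦ ⟪ u ⟫ ι ⟧ x) ⟩
      tr i j (tr i j (⟦ ⟪ u ⟫ ι ⟧ x))  ≡˘⟨ cong (tr i j) (f≈u x) ⟩
      tr i j (f x)                     ≡⟨ cong (tr i j) (f≈v x) ⟩
      tr i j (tr k l (⟦ ⟪ v ⟫ ι ⟧ x))  ≡⟨ cong (tr i j) (tr-determined i≢j kl-i≡j (⟦ ⟪ v ⟫ ι ⟧ x)) ⟩
      tr i j (tr i j (⟦ ⟪ v ⟫ ι ⟧ x))  ≡⟨ tr-involutive i j (⟦ ⟪ v ⟫ ι ⟧ x) ⟩
      ⟦ ⟪ v ⟫ ι ⟧ x                    ∎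

  commonNeighbour-transfer : {u v : Word m} {cs : List (Word m)} →
    ¬ perm u ≈ perm v → CommonNeighboursAmong u v cs →
    ⟦ ⟪ u ⟫ ι ⟧ ∼ f → ⟦ ⟪ v ⟫ ι ⟧ ∼ f → Any (λ c → ∀ x → f x ≡ ⟦ ⟪ c ⟫ ι ⟧ x) cs
  commonNeighbour-transfer {f = f} {u} {v} u≉v common (edge i j i≢j f≈u) v∼f@(edge k l k≢l f≈v)
    with commonNeighbour-endpoint {u = u} {v} u≉v i≢j f≈u v∼f
       | commonNeighbour-endpoint {u = u} {v} u≉v (i≢j ∘ sym)
           (λ x → trans (f≈u x) (tr-comm i j (⟦ ⟪ u ⟫ ι ⟧ x))) v∼f
  ... | i′ , refl | j′ , refl =
    Any.map (λ {c} c≈ x → trans (f≈u x) (⟪⟫-cong {(i′ , j′) ∷ u} {c} c≈ x))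
            (common i′ j′ (i≢j ∘ cong (to ι)) (∼-reflect {v} {(i′ , j′) ∷ u} v∼c))
    where
    v∼c : ⟦ ⟪ v ⟫ ι ⟧ ∼ ⟦ ⟪ (i′ , j′) ∷ u ⟫ ι ⟧
    v∼c = edge k l k≢l λ x → trans (sym (f≈u x)) (f≈v x)

-- Automorphisms

automorphism : (∀ {α β} → α ≈ β → φ α ≈ φ β) → (∀ {α β} → φ α ≈ φ β → α ≈ β) →
  (∀ β → ∃ λ α → φ α ≈ β) → (∀ {α β} → ⟦ α ⟧ ∼ ⟦ β ⟧ → ⟦ φ α ⟧ ∼ ⟦ φ β ⟧) →
  (∀ {α β} → ⟦ φ α ⟧ ∼ ⟦ φ β ⟧ → ⟦ α ⟧ ∼ ⟦ β ⟧) → IsAutomorphism φ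
automorphism {φ = φ} φ-cong φ-injective φ-surjective φ-∼ φ-∼⁻ =
  (λ _ _ → φ-cong) , (λ _ _ → φ-injective) , φ-surjective ,
  λ α β → (∼⇒Adj {α = φ α} {φ β} ∘ φ-∼ ∘ Adj⇒∼ {α = α} {β}) ,
          (∼⇒Adj {α = α} {β} ∘ φ-∼⁻ ∘ Adj⇒∼ {α = φ α} {φ β})

module Automorphism {n} {φ : Sym n → Sym n} (φ-aut : IsAutomorphism φ) where

  φ-cong : α ≈ β → φ α ≈ φ β
  φ-cong {α} {β} = proj₁ φ-aut α β

  φ-injective : φ α ≈ φ β → α ≈ β
  φ-injective {α} {β} = proj₁ (proj₂ φ-aut) α β

  φ-surjective : ∀ β → ∃ λ α → φ α ≈ β
  φ-surjective = proj₁ (proj₂ (proj₂ φ-aut))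

  φ-∼ : ⟦ α ⟧ ∼ ⟦ β ⟧ → ⟦ φ α ⟧ ∼ ⟦ φ β ⟧
  φ-∼ {α} {β} = Adj⇒∼ {α = φ α} {φ β} ∘ proj₁ (proj₂ (proj₂ (proj₂ φ-aut)) α β) ∘ ∼⇒Adj {α = α} {β}

  φ-∼⁻ : ⟦ φ α ⟧ ∼ ⟦ φ β ⟧ → ⟦ α ⟧ ∼ ⟦ β ⟧
  φ-∼⁻ {α} {β} = Adj⇒∼ {α = α} {β} ∘ proj₂ (proj₂ (proj₂ (proj₂ φ-aut)) α β) ∘ ∼⇒Adj {α = φ α} {φ β}

  Fixed : Sym n → Set
  Fixed σ = φ σ ≈ σ

  fixed-resp : α ≈ β → Fixed α → Fixed β
  fixed-resp α≈β α-fixed x = trans (φ-cong (λ y → sym (α≈β y)) x) (trans (α-fixed x) (α≈β x))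

  fixed-∼ : Fixed α → ⟦ α ⟧ ∼ ⟦ β ⟧ → ⟦ α ⟧ ∼ ⟦ φ β ⟧
  fixed-∼ α-fixed α∼β = ∼-resp α-fixed (λ _ → refl) (φ-∼ α∼β)

  fixed-preimage : φ α ≈ β → Fixed β → α ≈ β
  fixed-preimage φα≈β β-fixed = φ-injective λ x → trans (φα≈β x) (sym (β-fixed x))

  module _ (ι : Fin m ↣ Fin n) where
    open Transfer ι

    commonNeighbour-image : (u v w : Word m) (cs : List (Word m)) →
      {True (¬? (perm u ≈? perm v))} → {True (commonNeighboursAmong? u v cs)} →
      {True (⟦ perm u ⟧ ∼? ⟦ perm w ⟧)} → {True (⟦ perm v ⟧ ∼? ⟦ perm w ⟧)} →
      Fixed (⟪ u ⟫ ι) → Fixed (⟪ v ⟫ ι) → Any (λ c → φ (⟪ w ⟫ ι) ≈ ⟪ c ⟫ ι) cs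
    commonNeighbour-image u v w cs {u≉v} {common} {u∼w} {v∼w} u-fixed v-fixed =
      commonNeighbour-transfer {u = u} {v = v} {cs = cs} (toWitness u≉v) (toWitness common)
        (fixed-∼ u-fixed (∼-transfer {u} {w} (toWitness u∼w)))
        (fixed-∼ v-fixed (∼-transfer {v} {w} (toWitness v∼w)))

    image-avoids-fixed : (w c : Word m) → {False (perm w ≈? perm c)} →
      Fixed (⟪ c ⟫ ι) → ¬ φ (⟪ w ⟫ ι) ≈ ⟪ c ⟫ ι
    image-avoids-fixed w c {w≉c} c-fixed φw≈c =
      toWitnessFalse w≉c (⟪⟫-reflect {w} {c} (fixed-preimage φw≈c c-fixed))

    image-avoids-nonNeighbour : (u w c : Word m) →
      {True (⟦ perm u ⟧ ∼? ⟦ perm w ⟧)} → {False (⟦ perm u ⟧ ∼? ⟦ perm c ⟧)} →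
      Fixed (⟪ u ⟫ ι) → ¬ φ (⟪ w ⟫ ι) ≈ ⟪ c ⟫ ι
    image-avoids-nonNeighbour u w c {u∼w} {u≁c} u-fixed φw≈c =
      toWitnessFalse u≁c (∼-reflect {u} {c}
        (∼-resp (λ _ → refl) φw≈c (fixed-∼ u-fixed (∼-transfer {u} {w} (toWitness u∼w)))))

id-automorphism : IsAutomorphism {n} id
id-automorphism = automorphism {φ = id} id id (λ β → β , λ _ → refl) id id

inv-automorphism : IsAutomorphism {n} inv
inv-automorphism = automorphism {φ = inv} (λ {α} {β} → inv-cong {α = α} {β})
  (λ {α} {β} → inv-cong {α = inv α} {inv β}) (λ β → inv β , λ _ → refl)
  (λ {α} {β} → inv-∼ {α = α} {β}) (λ {α} {β} → inv-∼ {α = inv α} {inv β})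

∘-automorphism : IsAutomorphism φ → IsAutomorphism ψ → IsAutomorphism (φ ∘ ψ)
∘-automorphism {φ = φ} {ψ = ψ} φ-aut ψ-aut = automorphism {φ = φ ∘ ψ}
  (Φ.φ-cong ∘ Ψ.φ-cong) (Ψ.φ-injective ∘ Φ.φ-injective) surjective (Φ.φ-∼ ∘ Ψ.φ-∼) (Ψ.φ-∼⁻ ∘ Φ.φ-∼⁻)
  where
  module Φ = Automorphism {φ = φ} φ-aut
  module Ψ = Automorphism {φ = ψ} ψ-aut
  surjective : ∀ γ → ∃ λ α → φ (ψ α) ≈ γ
  surjective γ =
    let β , φβ≈γ = Φ.φ-surjective γ
        α , ψα≈β = Ψ.φ-surjective β
    in α , λ x → trans (Φ.φ-cong ψα≈β x) (φβ≈γ x)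

translation-automorphism : (α : Sym n) → IsAutomorphism (α ∘ₚ_)
translation-automorphism α = automorphism {φ = α ∘ₚ_}
  (λ σ≈τ → σ≈τ ∘ ⟦ α ⟧)
  (λ {σ} {τ} ασ≈ατ y → trans (cong ⟦ σ ⟧ (sym (inverseʳ α))) (trans (ασ≈ατ _) (cong ⟦ τ ⟧ (inverseʳ α))))
  (λ τ → inv α ∘ₚ τ , λ x → cong ⟦ τ ⟧ (inverseˡ α))
  (∼-∘ʳ ⟦ α ⟧)
  λ {σ} {τ} ασ∼ατ → ∼-resp (λ y → cong ⟦ σ ⟧ (inverseʳ α)) (λ y → cong ⟦ τ ⟧ (inverseʳ α))
                            (∼-∘ʳ ⟦ inv α ⟧ ασ∼ατ)

neighbour-fixed : InLe φ → ⟦ e ⟧ ∼ ⟦ β ⟧ → φ β ≈ β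
neighbour-fixed {β = β} (_ , _ , fixes) e∼β = fixes β (∼⇒Adj {α = e} {β} e∼β)

id∈Le : InLe {n} id
id∈Le = id-automorphism , (λ _ → refl) , λ _ _ _ → refl

inv∈Le : InLe {n} inv
inv∈Le {n} = inv-automorphism {n} , (λ _ → refl) ,
  λ β e-β → inv-unique {β = β} (involution {β = β} (Adj⇒∼ {α = e} {β} e-β))
  where
  involution : ⟦ e ⟧ ∼ ⟦ β ⟧ → ∀ y → ⟦ β ⟧ (⟦ β ⟧ y) ≡ y
  involution {β = β} (edge i j _ β≈) y =
    trans (β≈ (⟦ β ⟧ y)) (trans (cong (tr i j) (β≈ y)) (tr-involutive i j y))

∘∈Le : InLe φ → InLe ψ → InLe (φ ∘ ψ)
∘∈Le {φ = φ} {ψ = ψ} φ∈Le@(φ-aut , φe≈e , _) ψ∈Le@(ψ-aut , ψe≈e , _) =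
  ∘-automorphism {φ = φ} {ψ} φ-aut ψ-aut ,
  (λ x → trans (Φ.φ-cong ψe≈e x) (φe≈e x)) ,
  λ β e-β → let e∼β = Adj⇒∼ {α = e} {β} e-β in
    λ x → trans (Φ.φ-cong {ψ β} {β} (neighbour-fixed {φ = ψ} ψ∈Le e∼β) x)
                (neighbour-fixed {φ = φ} φ∈Le e∼β x)
  where module Φ = Automorphism {φ = φ} φ-aut

-- The ball of radius 2 around e

ρ ρ⁻¹ : Word 3
ρ   = (1F , 2F) ∷ (0F , 1F) ∷ []
ρ⁻¹ = (0F , 1F) ∷ (1F , 2F) ∷ []

δ : Word 4
δ = (2F , 3F) ∷ (0F , 1F) ∷ []

rotation swap₁₂ : Fin 3 ↣ Fin 3
rotation = select (1F ∷ 2F ∷ 0F ∷ [])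
swap₁₂   = select (0F ∷ 2F ∷ 1F ∷ [])

inv-⟪ρ⁻¹⟫ : (ι : Fin 3 ↣ Fin n) → inv (⟪ ρ⁻¹ ⟫ ι) ≈ ⟪ ρ ⟫ ι
inv-⟪ρ⁻¹⟫ ι =
  inv-unique {β = ⟪ ρ⁻¹ ⟫ ι} (Transfer.⟪⟫-cong ι {ρ⁻¹ ++ ρ} {[]} (from-yes (perm (ρ⁻¹ ++ ρ) ≈? e)))

⟪ρ⟫-not-involution : (ι : Fin 3 ↣ Fin n) → ¬ inv (⟪ ρ ⟫ ι) ≈ ⟪ ρ ⟫ ι
⟪ρ⟫-not-involution ι inv≈ = from-no (perm (ρ ++ ρ) ≈? e) (Transfer.⟪⟫-reflect ι {ρ ++ ρ} {[]}
  λ x → trans (cong ⟦ ⟪ ρ ⟫ ι ⟧ (sym (inv≈ x))) (inverseʳ (⟪ ρ ⟫ ι)))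

product-of-transpositions : i ≢ j → k ≢ l →
  (∀ x → tr k l (tr i j x) ≡ x) ⊎
  (∃ λ (ι : Fin 3 ↣ Fin n) → ∀ x → tr k l (tr i j x) ≡ ⟦ ⟪ ρ ⟫ ι ⟧ x) ⊎
  (∃ λ (κ : Fin 4 ↣ Fin n) → ∀ x → tr k l (tr i j x) ≡ ⟦ ⟪ δ ⟫ κ ⟧ x)
product-of-transpositions {i = i} {j} {k} {l} i≢j k≢l with position k i j | position l i j
... | inj₁ refl              | inj₁ refl                = contradiction refl k≢l
... | inj₁ refl              | inj₂ (inj₁ (_ , refl))   = inj₁ (tr-involutive i j)
... | inj₁ refl              | inj₂ (inj₂ (l≢i , l≢j)) =
  inj₂ (inj₁ (triple (i≢j ∘ sym) (l≢j ∘ sym) (l≢i ∘ sym) , λ x → cong (tr i l) (tr-comm i j x)))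
... | inj₂ (inj₁ (_ , refl)) | inj₁ refl                =
  inj₁ λ x → trans (tr-comm j i (tr i j x)) (tr-involutive i j x)
... | inj₂ (inj₁ (_ , refl)) | inj₂ (inj₁ (_ , refl))   = contradiction refl k≢l
... | inj₂ (inj₁ (_ , refl)) | inj₂ (inj₂ (l≢i , l≢j)) =
  inj₂ (inj₁ (triple i≢j (l≢i ∘ sym) (l≢j ∘ sym) , λ _ → refl))
... | inj₂ (inj₂ (k≢i , k≢j)) | inj₁ refl               =
  inj₂ (inj₁ (triple (i≢j ∘ sym) (k≢j ∘ sym) (k≢i ∘ sym) ,
              λ x → trans (tr-comm k i (tr i j x)) (cong (tr i k) (tr-comm i j x))))
... | inj₂ (inj₂ (k≢i , k≢j)) | inj₂ (inj₁ (_ , refl)) =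
  inj₂ (inj₁ (triple i≢j (k≢i ∘ sym) (k≢j ∘ sym) , λ x → tr-comm k j (tr i j x)))
... | inj₂ (inj₂ (k≢i , k≢j)) | inj₂ (inj₂ (l≢i , l≢j)) =
  inj₂ (inj₂ (quadruple i≢j (k≢i ∘ sym) (l≢i ∘ sym) (k≢j ∘ sym) (l≢j ∘ sym) k≢l , λ _ → refl))

avoiding : (ι : Fin 3 ↣ Fin n) (s : Fin n) → ∃ λ r → r ≢ to ι 0F × r ≢ s
avoiding ι s with to ι 1F ≟ s
... | no b≢s  = to ι 1F , (λ b≡a → contradiction (injective ι b≡a) λ ()) , b≢s
... | yes b≡s = to ι 2F , (λ c≡a → contradiction (injective ι c≡a) λ ()) ,
                          λ c≡s → contradiction (injective ι (trans c≡s (sym b≡s))) λ ()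

third-point : Fin 3 ↣ Fin n → (p q : Fin n) → ∃ λ r → r ≢ p × r ≢ q
third-point ι p q with to ι 0F ≟ p | to ι 0F ≟ q
... | no a≢p   | no a≢q   = to ι 0F , a≢p , a≢q
... | yes refl | _        = avoiding ι q
... | no _     | yes refl = let r , r≢q , r≢p = avoiding ι p in r , r≢p , r≢q

module Local {n} {ψ : Sym n → Sym n} (ψ∈Le : InLe ψ) where
  open Automorphism {φ = ψ} (proj₁ ψ∈Le)

  e-fixed : Fixed e
  e-fixed = proj₁ (proj₂ ψ∈Le)

  transposition-fixed : (ι : Fin m ↣ Fin n) {i j : Fin m} → i ≢ j → Fixed (⟪ (i , j) ∷ [] ⟫ ι)
  transposition-fixed ι {i} {j} i≢j =
    neighbour-fixed {φ = ψ} ψ∈Le (edge (to ι i) (to ι j) (i≢j ∘ injective ι) λ _ → refl)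

  double-fixed : (κ : Fin 4 ↣ Fin n) → Fixed (⟪ δ ⟫ κ)
  double-fixed κ = among-e-δ (commonNeighbour-image κ ((0F , 1F) ∷ []) ((2F , 3F) ∷ []) δ ([] ∷ δ ∷ [])
                               (transposition-fixed κ λ ()) (transposition-fixed κ λ ()))
    where
    among-e-δ : Any (λ c → ψ (⟪ δ ⟫ κ) ≈ ⟪ c ⟫ κ) ([] ∷ δ ∷ []) → Fixed (⟪ δ ⟫ κ)
    among-e-δ (here ψδ≈e)         = contradiction ψδ≈e (image-avoids-fixed κ δ [] e-fixed)
    among-e-δ (there (here ψδ≈δ)) = ψδ≈δ

  cycle-fixed-or-inverted : (ι : Fin 3 ↣ Fin n) → Fixed (⟪ ρ ⟫ ι) ⊎ ψ (⟪ ρ ⟫ ι) ≈ ⟪ ρ⁻¹ ⟫ ι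
  cycle-fixed-or-inverted ι =
    among-e-ρ-ρ⁻¹ (commonNeighbour-image ι ((0F , 1F) ∷ []) ((1F , 2F) ∷ []) ρ ([] ∷ ρ ∷ ρ⁻¹ ∷ [])
                     (transposition-fixed ι λ ()) (transposition-fixed ι λ ()))
    where
    among-e-ρ-ρ⁻¹ : Any (λ c → ψ (⟪ ρ ⟫ ι) ≈ ⟪ c ⟫ ι) ([] ∷ ρ ∷ ρ⁻¹ ∷ []) →
                    Fixed (⟪ ρ ⟫ ι) ⊎ ψ (⟪ ρ ⟫ ι) ≈ ⟪ ρ⁻¹ ⟫ ι
    among-e-ρ-ρ⁻¹ (here ψρ≈e)                 = contradiction ψρ≈e (image-avoids-fixed ι ρ [] e-fixed)
    among-e-ρ-ρ⁻¹ (there (here ψρ≈ρ))         = inj₁ ψρ≈ρ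
    among-e-ρ-ρ⁻¹ (there (there (here ψρ≈ρ⁻¹))) = inj₂ ψρ≈ρ⁻¹

  FixesCycle : Fin 3 ↣ Fin n → Set
  FixesCycle ι = Fixed (⟪ ρ ⟫ ι)

  fixesCycle-cong : {ι κ : Fin 3 ↣ Fin n} → (∀ k → to ι k ≡ to κ k) → FixesCycle ι → FixesCycle κ
  fixesCycle-cong {ι} {κ} ι≈κ = fixed-resp {⟪ ρ ⟫ ι} {⟪ ρ ⟫ κ} (⟪⟫-pointwise {ι = ι} {κ} ι≈κ ρ)

  fixesCycle-rotate : {ι : Fin 3 ↣ Fin n} → FixesCycle ι → FixesCycle (ι ↣-∘ rotation)
  fixesCycle-rotate {ι} = fixed-resp {⟪ ρ ⟫ ι} {⟪ ρ at (1F ∷ 2F ∷ 0F ∷ []) ⟫ ι}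
    (Transfer.⟪⟫-cong ι {ρ} {ρ at (1F ∷ 2F ∷ 0F ∷ [])}
      (from-yes (perm ρ ≈? perm (ρ at (1F ∷ 2F ∷ 0F ∷ [])))))

  fixesCycle-swap : {ι : Fin 3 ↣ Fin n} → FixesCycle ι → FixesCycle (ι ↣-∘ swap₁₂)
  fixesCycle-swap {ι} ρ-fixed = [ id , ⊥-elim ∘ not-inverted ]′ (cycle-fixed-or-inverted (ι ↣-∘ swap₁₂))
    where
    ρ₀₂₁ = ρ at (0F ∷ 2F ∷ 1F ∷ [])
    ρ⁻¹₀₂₁≈ρ : ⟪ ρ⁻¹ at (0F ∷ 2F ∷ 1F ∷ []) ⟫ ι ≈ ⟪ ρ ⟫ ι
    ρ⁻¹₀₂₁≈ρ = Transfer.⟪⟫-cong ι {ρ⁻¹ at (0F ∷ 2F ∷ 1F ∷ [])} {ρ}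
                 (from-yes (perm (ρ⁻¹ at (0F ∷ 2F ∷ 1F ∷ [])) ≈? perm ρ))
    not-inverted : ¬ ψ (⟪ ρ₀₂₁ ⟫ ι) ≈ ⟪ ρ⁻¹ at (0F ∷ 2F ∷ 1F ∷ []) ⟫ ι
    not-inverted inverted = image-avoids-fixed ι ρ₀₂₁ ρ ρ-fixed λ x → trans (inverted x) (ρ⁻¹₀₂₁≈ρ x)

  -- y is a common neighbour of the fixed double transpositions δ₁ and δ₂, so ψ y is y or y′;
  -- only y is adjacent to the fixed 3-cycle ρ₁₂₃. Then ψ ρ₁₂₀ is adjacent to y, which the
  -- inverse of ρ₁₂₀ is not.
  fixesCycle-exchange : (κ : Fin 4 ↣ Fin n) →
    FixesCycle (κ ↣-∘ select (1F ∷ 2F ∷ 3F ∷ [])) → FixesCycle (κ ↣-∘ select (1F ∷ 2F ∷ 0F ∷ []))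
  fixesCycle-exchange κ ρ₁₂₃-fixed =
    [ id , ⊥-elim ∘ image-avoids-nonNeighbour κ y ρ₁₂₀ (ρ⁻¹ at (1F ∷ 2F ∷ 0F ∷ [])) y-fixed ]′
      (cycle-fixed-or-inverted (κ ↣-∘ select (1F ∷ 2F ∷ 0F ∷ [])))
    where
    ρ₁₂₃ ρ₁₂₀ δ₁ δ₂ y y′ : Word 4
    ρ₁₂₃ = ρ at (1F ∷ 2F ∷ 3F ∷ [])
    ρ₁₂₀ = ρ at (1F ∷ 2F ∷ 0F ∷ [])
    δ₁   = δ at (1F ∷ 2F ∷ 3F ∷ 0F ∷ [])
    δ₂   = δ at (1F ∷ 3F ∷ 2F ∷ 0F ∷ [])
    y    = (2F , 3F) ∷ δ₁
    y′   = (1F , 0F) ∷ δ₁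
    among-y-y′ : Any (λ c → ψ (⟪ y ⟫ κ) ≈ ⟪ c ⟫ κ) (y ∷ y′ ∷ []) → Fixed (⟪ y ⟫ κ)
    among-y-y′ (here ψy≈y)          = ψy≈y
    among-y-y′ (there (here ψy≈y′)) =
      contradiction ψy≈y′ (image-avoids-nonNeighbour κ ρ₁₂₃ y y′ ρ₁₂₃-fixed)
    y-fixed : Fixed (⟪ y ⟫ κ)
    y-fixed = among-y-y′ (commonNeighbour-image κ δ₁ δ₂ y (y ∷ y′ ∷ [])
                (double-fixed (κ ↣-∘ select (1F ∷ 2F ∷ 3F ∷ 0F ∷ [])))
                (double-fixed (κ ↣-∘ select (1F ∷ 3F ∷ 2F ∷ 0F ∷ []))))

  fixesCycle-replace-third : {ι κ : Fin 3 ↣ Fin n} → FixesCycle ι →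
    to κ 0F ≡ to ι 0F → to κ 1F ≡ to ι 1F → FixesCycle κ
  fixesCycle-replace-third {ι} {κ} ρ-fixed κ₀≡ι₀ κ₁≡ι₁ with to κ 2F ≟ to ι 2F
  ... | yes κ₂≡ι₂ =
    fixesCycle-cong {ι = ι} {κ} (λ { 0F → sym κ₀≡ι₀ ; 1F → sym κ₁≡ι₁ ; 2F → sym κ₂≡ι₂ }) ρ-fixed
  ... | no κ₂≢ι₂  = fixesCycle-cong {ι = extended ↣-∘ select (1F ∷ 2F ∷ 0F ∷ [])} {κ}
                      (λ { 0F → sym κ₀≡ι₀ ; 1F → sym κ₁≡ι₁ ; 2F → refl })
                      (fixesCycle-exchange extended ρ-fixed)
    where
    κ-distinct : {k : Fin 3} → k ≢ 2F → to κ k ≢ to κ 2F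
    κ-distinct k≢2 = k≢2 ∘ injective κ
    extended : Fin 4 ↣ Fin n
    extended = cons (to κ 2F) ι λ
      { 0F → κ-distinct {0F} (λ ()) ∘ trans κ₀≡ι₀
      ; 1F → κ-distinct {1F} (λ ()) ∘ trans κ₁≡ι₁
      ; 2F → κ₂≢ι₂ ∘ sym }

  fixedCycle-with-first : {ι : Fin 3 ↣ Fin n} → FixesCycle ι → (x : Fin n) →
    ∃ λ (ι′ : Fin 3 ↣ Fin n) → to ι′ 0F ≡ x × FixesCycle ι′
  fixedCycle-with-first {ι} ρ-fixed x with x ≟ to ι 0F | x ≟ to ι 1F | x ≟ to ι 2F
  ... | yes refl | _        | _        = ι , refl , ρ-fixed
  ... | no _     | yes refl | _        = ι ↣-∘ rotation , refl , fixesCycle-rotate {ι = ι} ρ-fixed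
  ... | no _     | no _     | yes refl =
    (ι ↣-∘ rotation) ↣-∘ rotation , refl ,
    fixesCycle-rotate {ι = ι ↣-∘ rotation} (fixesCycle-rotate {ι = ι} ρ-fixed)
  ... | no x≢a   | no x≢b   | no x≢c   =
    (bcx ↣-∘ rotation) ↣-∘ rotation , refl ,
    fixesCycle-rotate {ι = bcx ↣-∘ rotation} (fixesCycle-rotate {ι = bcx}
      (fixesCycle-replace-third {ι = ι ↣-∘ rotation} {bcx} (fixesCycle-rotate {ι = ι} ρ-fixed) refl refl))
    where
    bcx : Fin 3 ↣ Fin n
    bcx = triple (λ b≡c → contradiction (injective ι b≡c) λ ()) (x≢b ∘ sym) (x≢c ∘ sym)

  fixedCycle-with-second : {ι : Fin 3 ↣ Fin n} → FixesCycle ι → (y : Fin n) → y ≢ to ι 0F →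
    ∃ λ (ι′ : Fin 3 ↣ Fin n) → to ι′ 0F ≡ to ι 0F × to ι′ 1F ≡ y × FixesCycle ι′
  fixedCycle-with-second {ι} ρ-fixed y y≢a with y ≟ to ι 1F | y ≟ to ι 2F
  ... | yes refl | _        = ι , refl , refl , ρ-fixed
  ... | no _     | yes refl = ι ↣-∘ swap₁₂ , refl , refl , fixesCycle-swap {ι = ι} ρ-fixed
  ... | no y≢b   | no y≢c   =
    aby ↣-∘ swap₁₂ , refl , refl ,
    fixesCycle-swap {ι = aby} (fixesCycle-replace-third {ι = ι} {aby} ρ-fixed refl refl)
    where
    aby : Fin 3 ↣ Fin n
    aby = triple (λ a≡b → contradiction (injective ι a≡b) λ ()) (y≢a ∘ sym) (y≢b ∘ sym)

  spread : {ι : Fin 3 ↣ Fin n} → FixesCycle ι → (κ : Fin 3 ↣ Fin n) → FixesCycle κ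
  spread {ι} ρ-fixed κ =
    let ι₁ , ι₁₀≡κ₀ , ρ₁-fixed = fixedCycle-with-first {ι = ι} ρ-fixed (to κ 0F)
        κ₁≢ι₁₀ = λ κ₁≡ι₁₀ → contradiction (injective κ (trans κ₁≡ι₁₀ ι₁₀≡κ₀)) λ ()
        ι₂ , ι₂₀≡ι₁₀ , ι₂₁≡κ₁ , ρ₂-fixed = fixedCycle-with-second {ι = ι₁} ρ₁-fixed (to κ 1F) κ₁≢ι₁₀
    in fixesCycle-replace-third {ι = ι₂} {κ} ρ₂-fixed (sym (trans ι₂₀≡ι₁₀ ι₁₀≡κ₀)) (sym ι₂₁≡κ₁)

  product-fixed : (ι : Fin 3 ↣ Fin n) → FixesCycle ι → {i j k l : Fin n} {σ : Sym n} →
    i ≢ j → k ≢ l → (∀ x → ⟦ σ ⟧ x ≡ tr k l (tr i j x)) → Fixed σ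
  product-fixed ι ρ-fixed {σ = σ} i≢j k≢l σ≈ with product-of-transpositions i≢j k≢l
  ... | inj₁ ≈id             = fixed-resp {e} {σ} (λ x → sym (trans (σ≈ x) (≈id x))) e-fixed
  ... | inj₂ (inj₁ (κ , ≈ρ)) = fixed-resp {⟪ ρ ⟫ κ} {σ} (λ x → sym (trans (σ≈ x) (≈ρ x)))
                                 (spread {ι = ι} ρ-fixed κ)
  ... | inj₂ (inj₂ (κ , ≈δ)) = fixed-resp {⟪ δ ⟫ κ} {σ} (λ x → sym (trans (σ≈ x) (≈δ x)))
                                 (double-fixed κ)

  ball₂-fixed : (ι : Fin 3 ↣ Fin n) → FixesCycle ι → FixesBall₂ ψ e
  ball₂-fixed ι ρ-fixed σ (one e∼σ) = neighbour-fixed {φ = ψ} ψ∈Le e∼σ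
  ball₂-fixed ι ρ-fixed σ (two (edge i j i≢j g≈) (edge k l k≢l σ≈)) =
    product-fixed ι ρ-fixed i≢j k≢l λ x → trans (σ≈ x) (cong (tr k l) (g≈ x))

ball₂-fixed-or-inverted : {φ : Sym n → Sym n} → Fin 3 ↣ Fin n → InLe φ →
  FixesBall₂ φ e ⊎ FixesBall₂ (inv ∘ φ) e
ball₂-fixed-or-inverted {φ = φ} ι φ∈Le =
  [ inj₁ ∘ Local.ball₂-fixed {ψ = φ} φ∈Le ι
  , (λ inverted → inj₂ (Local.ball₂-fixed {ψ = inv ∘ φ} inv∘φ∈Le ι λ x →
       trans (inv-cong {α = φ (⟪ ρ ⟫ ι)} {⟪ ρ⁻¹ ⟫ ι} inverted x) (inv-⟪ρ⁻¹⟫ ι x))) ]′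
  (Local.cycle-fixed-or-inverted {ψ = φ} φ∈Le ι)
  where
  inv∘φ∈Le : InLe (inv ∘ φ)
  inv∘φ∈Le = ∘∈Le {φ = inv} {φ} inv∈Le φ∈Le

-- Propagation along edges

conjugate : Sym n → (Sym n → Sym n) → Sym n → Sym n
conjugate α φ σ = inv α ∘ₚ φ (α ∘ₚ σ)

conjugate-automorphism : IsAutomorphism φ → IsAutomorphism (conjugate α φ)
conjugate-automorphism {φ = φ} {α = α} φ-aut =
  ∘-automorphism {φ = inv α ∘ₚ_} {φ ∘ (α ∘ₚ_)} (translation-automorphism (inv α))
    (∘-automorphism {φ = φ} {α ∘ₚ_} φ-aut (translation-automorphism α))

conjugate-fixed : φ (α ∘ₚ σ) ≈ α ∘ₚ σ → conjugate α φ σ ≈ σ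
conjugate-fixed {α = α} {σ = σ} fixed y = trans (fixed (⟦ inv α ⟧ y)) (cong ⟦ σ ⟧ (inverseʳ α))

fixesBall₂-conjugate : IsAutomorphism φ → FixesBall₂ (conjugate α φ) e → FixesBall₂ φ α
fixesBall₂-conjugate {φ = φ} {α = α} φ-aut fixes γ γ∈ball x = begin
  ⟦ φ γ ⟧ x                              ≡⟨ φ-cong γ≈ατ x ⟩
  ⟦ φ (α ∘ₚ τ) ⟧ x                       ≡˘⟨ cong ⟦ φ (α ∘ₚ τ) ⟧ (inverseˡ α) ⟩
  ⟦ φ (α ∘ₚ τ) ⟧ (⟦ inv α ⟧ (⟦ α ⟧ x))  ≡⟨ fixes τ τ∈ball (⟦ α ⟧ x) ⟩
  ⟦ γ ⟧ (⟦ inv α ⟧ (⟦ α ⟧ x))           ≡⟨ cong ⟦ γ ⟧ (inverseˡ α) ⟩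
  ⟦ γ ⟧ x                                ∎
  where
  open ≡-Reasoning
  open Automorphism {φ = φ} φ-aut
  τ : Sym _
  τ = inv α ∘ₚ γ
  γ≈ατ : γ ≈ α ∘ₚ τ
  γ≈ατ x = sym (cong ⟦ γ ⟧ (inverseˡ α))
  τ∈ball : Ball₂ ⟦ e ⟧ ⟦ τ ⟧
  τ∈ball = Ball₂-resp (λ _ → inverseʳ α) (Ball₂-∘ʳ ⟦ inv α ⟧ γ∈ball)

fixesBall₂-resp : {φ : Sym n → Sym n} → α ≈ β → FixesBall₂ φ α → FixesBall₂ φ β
fixesBall₂-resp α≈β fixes γ γ∈ball = fixes γ (Ball₂-resp (λ x → sym (α≈β x)) γ∈ball)

-- The conjugate φ′ of φ by α lies in L_e. It cannot invert the ball around e: it fixes the 3-cycle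
-- w = (q r)(p q), because α ∘ₚ w = β ∘ₚ (q r) lies in the ball around β.
fixesBall₂-step : {φ : Sym n → Sym n} → Fin 3 ↣ Fin n → IsAutomorphism φ →
  FixesBall₂ φ β → ⟦ β ⟧ ∼ ⟦ α ⟧ → FixesBall₂ φ α
fixesBall₂-step {n} {β} {α} {φ} ι₀ φ-aut β-fixes β∼α@(edge p q p≢q α≈) =
  [ fixesBall₂-conjugate {φ = φ} {α} φ-aut , ⊥-elim ∘ not-inverted ]′
  (ball₂-fixed-or-inverted {φ = φ′} ι₀ φ′∈Le)
  where
  φ′ : Sym n → Sym n
  φ′ = conjugate α φ
  φ′∈Le : InLe φ′
  φ′∈Le = conjugate-automorphism {φ = φ} {α} φ-aut ,
         conjugate-fixed {φ = φ} {α} {e} (β-fixes (α ∘ₚ e) (one β∼α)) ,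
         λ σ e-σ → conjugate-fixed {φ = φ} {α} {σ}
           (β-fixes (α ∘ₚ σ) (two β∼α (∼-∘ʳ ⟦ α ⟧ (Adj⇒∼ {α = e} {σ} e-σ))))
  r : Fin n
  r = proj₁ (third-point ι₀ p q)
  r≢p = proj₁ (proj₂ (third-point ι₀ p q))
  r≢q = proj₂ (proj₂ (third-point ι₀ p q))
  ι : Fin 3 ↣ Fin n
  ι = triple {a = p} {q} {r} p≢q (r≢p ∘ sym) (r≢q ∘ sym)
  w : Sym n
  w = ⟪ ρ ⟫ ι
  w∈ball : Ball₂ ⟦ e ⟧ ⟦ w ⟧
  w∈ball = two (edge p q p≢q λ _ → refl) (edge q r (r≢q ∘ sym) λ _ → refl)
  w-fixed : φ′ w ≈ w
  w-fixed = conjugate-fixed {φ = φ} {α} {w} (β-fixes (α ∘ₚ w) (one (edge q r (r≢q ∘ sym) λ x →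
    cong (tr q r) (trans (cong (tr p q) (α≈ x)) (tr-involutive p q (⟦ β ⟧ x))))))
  not-inverted : ¬ FixesBall₂ (inv ∘ φ′) e
  not-inverted inv∘φ′-fixes = ⟪ρ⟫-not-involution ι λ x →
    trans (inv-cong {α = w} {φ′ w} (λ y → sym (w-fixed y)) x) (inv∘φ′-fixes w w∈ball x)

-- Swapping p and α p turns α into a neighbour that also fixes p.
fixing-point-extends : {P : Sym n → Set} → (∀ {α β} → P β → ⟦ β ⟧ ∼ ⟦ α ⟧ → P α) →
  {m : ℕ} (m<n : m < n) → (∀ β → (∀ x → m ≤ toℕ x → ⟦ β ⟧ x ≡ x) → P β) →
  ∀ α → (∀ x → suc m ≤ toℕ x → ⟦ α ⟧ x ≡ x) → P α
fixing-point-extends {n} {P} P-step {m} m<n P-below α fixes = by-cases (⟦ α ⟧ p ≟ p)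
  where
  p : Fin n
  p = fromℕ< m<n
  at-or-above : m ≤ toℕ x → x ≡ p ⊎ suc m ≤ toℕ x
  at-or-above m≤x = [ inj₂ , (λ m≡x → inj₁ (toℕ-injective (trans (sym m≡x) (sym (toℕ-fromℕ< m<n))))) ]′
                    (m≤n⇒m<n∨m≡n m≤x)
  above⇒≢p : suc m ≤ toℕ x → x ≢ p
  above⇒≢p m<x refl = <-irrefl (sym (toℕ-fromℕ< m<n)) m<x
  by-cases : Dec (⟦ α ⟧ p ≡ p) → P α
  by-cases (yes αp≡p) = P-below α λ x m≤x → [ (λ { refl → αp≡p }) , fixes x ]′ (at-or-above m≤x)
  by-cases (no αp≢p)  = P-step {α} {α′} (P-below α′ α′-fixes)
                          (edge (⟦ α ⟧ p) p αp≢p λ x → sym (tr-involutive (⟦ α ⟧ p) p (⟦ α ⟧ x)))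
    where
    α′ : Sym n
    α′ = α ∘ₚ transpose (⟦ α ⟧ p) p
    α′-fixes : ∀ x → m ≤ toℕ x → ⟦ α′ ⟧ x ≡ x
    α′-fixes x m≤x = [ (λ { refl → tr-left (⟦ α ⟧ p) p }) , (λ m<x →
      trans (cong (tr (⟦ α ⟧ p) p) (fixes x m<x))
            (tr-fix (λ x≡αp → above⇒≢p m<x (⟦⟧-injective α (trans (fixes x m<x) x≡αp)))
                    (above⇒≢p m<x))) ]′ (at-or-above m≤x)

connected : {P : Sym n → Set} → (∀ {α β} → α ≈ β → P α → P β) →
  (∀ {α β} → P β → ⟦ β ⟧ ∼ ⟦ α ⟧ → P α) → P e → ∀ α → P α
connected {n} {P} P-resp P-step P-e α =
  fixing-from n α λ x n≤x → contradiction (≤-<-trans n≤x (toℕ<n x)) (<-irrefl refl)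
  where
  fixing-from : (m : ℕ) (α : Sym n) → (∀ x → m ≤ toℕ x → ⟦ α ⟧ x ≡ x) → P α
  fixing-from zero    α fixes = P-resp {e} {α} (λ x → sym (fixes x z≤n)) P-e
  fixing-from (suc m) α fixes with m <? n
  ... | no m≮n  = fixing-from m α λ x m≤x → contradiction (≤-<-trans m≤x (toℕ<n x)) m≮n
  ... | yes m<n = fixing-point-extends {P = P} P-step m<n (fixing-from m) α fixes

Le-fixing-ball₂ : {φ : Sym n → Sym n} → Fin 3 ↣ Fin n → InLe φ → FixesBall₂ φ e → φ ≗ₚ id
Le-fixing-ball₂ {φ = φ} ι (φ-aut , _) e-fixes α =
  connected {P = FixesBall₂ φ} (λ {α} {β} → fixesBall₂-resp {α = α} {β} {φ})
    (λ {α} {β} → fixesBall₂-step {β = β} {α} {φ} ι φ-aut) e-fixes α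
    α (Ball₂-centre {i = to ι 0F} {to ι 1F} (λ a≡b → contradiction (injective ι a≡b) λ ()))

Le-id-or-inv : {φ : Sym n → Sym n} → Fin 3 ↣ Fin n → InLe φ → φ ≗ₚ id ⊎ φ ≗ₚ inv
Le-id-or-inv {φ = φ} ι φ∈Le =
  [ inj₁ ∘ Le-fixing-ball₂ {φ = φ} ι φ∈Le
  , (λ inv∘φ-fixes → inj₂ λ α → inv-cong {α = inv (φ α)} {α}
                       (Le-fixing-ball₂ {φ = inv ∘ φ} ι (∘∈Le {φ = inv} {φ} inv∈Le φ∈Le)
                                        inv∘φ-fixes α)) ]′
  (ball₂-fixed-or-inverted {φ = φ} ι φ∈Le)

Le-near-e : {φ : Sym n → Sym n} → InLe φ → (∀ α → α ≈ e ⊎ ⟦ e ⟧ ∼ ⟦ α ⟧) → φ ≗ₚ id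
Le-near-e {φ = φ} φ∈Le@(φ-aut , φe≈e , _) near-e α =
  [ (λ α≈e x → trans (φ-cong {α} {e} α≈e x) (trans (φe≈e x) (sym (α≈e x))))
  , neighbour-fixed {φ = φ} φ∈Le ]′ (near-e α)
  where open Automorphism {φ = φ} φ-aut

Sym₁-trivial : (α : Sym 1) → α ≈ e
Sym₁-trivial α 0F with ⟦ α ⟧ 0F
... | 0F = refl

Sym₂-near-e : (α : Sym 2) → α ≈ e ⊎ ⟦ e ⟧ ∼ ⟦ α ⟧
Sym₂-near-e α with ⟦ α ⟧ 0F in α0 | ⟦ α ⟧ 1F in α1
... | 0F | 0F = contradiction (⟦⟧-injective α (trans α0 (sym α1))) λ ()
... | 0F | 1F = inj₁ λ { 0F → α0 ; 1F → α1 }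
... | 1F | 0F = inj₂ (edge 0F 1F (λ ()) λ { 0F → α0 ; 1F → α1 })
... | 1F | 1F = contradiction (⟦⟧-injective α (trans α0 (sym α1))) λ ()

Le-elements : (n : ℕ) (φ : Sym n → Sym n) → InLe φ → φ ≗ₚ id ⊎ φ ≗ₚ inv
Le-elements 0                   φ _    = inj₁ λ _ ()
Le-elements 1                   φ φ∈Le = inj₁ (Le-near-e {φ = φ} φ∈Le (inj₁ ∘ Sym₁-trivial))
Le-elements 2                   φ φ∈Le = inj₁ (Le-near-e {φ = φ} φ∈Le Sym₂-near-e)
Le-elements (suc (suc (suc n))) φ      =
  Le-id-or-inv {φ = φ} (triple {a = 0F} {1F} {2F} (λ ()) (λ ()) (λ ()))

mainTheorem9 : (n : ℕ) →
    InLe {n} id × InLe {n} inv ×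
    ((φ : Sym n → Sym n) → InLe φ → (φ ≗ₚ id) ⊎ (φ ≗ₚ inv))
mainTheorem9 n = id∈Le , inv∈Le , Le-elements n
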